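{- Let $(T_L,T_R)$, $(U_L,U_R)$, $(V_L,V_R)$ be pairs of unlabelled binary trees. For an element $w$ of the Baxter monoid $\mathrm{baxt}$ with $\mathrm{Sh}(\mathrm{P}(w)) = (T_L,T_R)$, let $N(w)$ be the number of pairs $(s,t) \in \mathrm{baxt}\times\mathrm{baxt}$ such that $st = w$, $\mathrm{Sh}(\mathrm{P}(s)) = (U_L,U_R)$ and $\mathrm{Sh}(\mathrm{P}(t)) = (V_L,V_R)$. Then $N(w)$ depends only on $(T_L,T_R)$, $(U_L,U_R)$ and $(V_L,V_R)$, and not on the content of $w$.
   Context: $\mathcal{A} = \{1,2,3,\ldots\}$ with the usual order; $\mathcal{A}^*$ the free monoid over $\mathcal{A}$. $\mathrm{rtree}(a_1\cdots a_k)$ is the right strict binary search tree obtained from the empty tree by inserting $a_k,\ldots,a_1$ in turn, where inserting $a$ creates a node at an empty position and otherwise recurses into the left subtree if $a \le$ root label, into the right subtree otherwise. $\mathrm{ltree}(a_1\cdots a_k)$ is the left strict binary search tree obtained from the empty tree by inserting $a_1,\ldots,a_k$ in turn, where inserting $a$ recurses into the right subtree if $a \ge$ root label and into the left subtree otherwise. The Baxter congruence: $u \equiv_{\mathrm{baxt}} v$ iff $\mathrm{ltree}(u)=\mathrm{ltree}(v)$ and $\mathrm{rtree}(u)=\mathrm{rtree}(v)$; it is a congruence and $\mathrm{baxt} = \mathcal{A}^*/{\equiv_{\mathrm{baxt}}}$. For $s \in \mathrm{baxt}$ represented by a word $u$, $\mathrm{P}(s) = (\mathrm{ltree}(u),\mathrm{rtree}(u))$,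 and $\mathrm{Sh}(\mathrm{P}(s))$ is the pair of underlying unlabelled rooted binary trees. -}

module Defs where

open import Data.Nat using (ℕ; _≤_; _≤?_; _<?_; _≟_)
open import Data.List using (List; []; _∷_; _++_; foldr; foldl; map; concatMap; filter; length; deduplicate)
open import Data.Product using (_×_; _,_; proj₁; proj₂)
open import Data.Product.Properties using (≡-dec)
open import Relation.Nullary using (Dec; yes; no; ¬_)
open import Relation.Nullary.Decidable using (_×-dec_)
open import Relation.Binary.PropositionalEquality using (_≡_; refl; cong; cong₂)
open import Relation.Binary.Definitions using (DecidableEquality)

-- Words over the alphabet (letters are natural numbers; the statement
-- restricts to positive letters, i.e. A = {1,2,3,...}).
Word : Set
Word = List ℕ

data LTree : Set where
  lf : LTree
  nd : LTree → ℕ → LTree → LTree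

data BTree : Set where
  lf : BTree
  nd : BTree → BTree → BTree

insR : ℕ → LTree → LTree
insR a lf = nd lf a lf
insR a (nd l b r) with a ≤? b
... | yes _ = nd (insR a l) b r
... | no  _ = nd l b (insR a r)

insL : ℕ → LTree → LTree
insL a lf = nd lf a lf
insL a (nd l b r) with a <? b
... | yes _ = nd (insL a l) b r
... | no  _ = nd l b (insL a r)

rtree : Word → LTree
rtree = foldr insR lf

ltree : Word → LTree
ltree = foldl (λ t a → insL a t) lf

P : Word → LTree × LTree
P u = ltree u , rtree u

_≡baxt_ : Word → Word → Set
u ≡baxt v = P u ≡ P v

shape : LTree → BTree
shape lf = lf
shape (nd l _ r) = nd (shape l) (shape r)

Sh : LTree × LTree → BTree × BTree
Sh (l , r) = shape l , shape r

nd-inj₁ : ∀ {l b r l' b' r'} → nd l b r ≡ nd l' b' r' → l ≡ l'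
nd-inj₁ refl = refl
nd-inj₂ : ∀ {l b r l' b' r'} → nd l b r ≡ nd l' b' r' → b ≡ b'
nd-inj₂ refl = refl
nd-inj₃ : ∀ {l b r l' b' r'} → nd l b r ≡ nd l' b' r' → r ≡ r'
nd-inj₃ refl = refl

_≟T_ : DecidableEquality LTree
lf ≟T lf = yes refl
lf ≟T nd _ _ _ = no (λ ())
nd _ _ _ ≟T lf = no (λ ())
nd l b r ≟T nd l' b' r' with l ≟T l' | b ≟ b' | r ≟T r'
... | yes refl | yes refl | yes refl = yes refl
... | no p | _ | _ = no (λ e → p (nd-inj₁ e))
... | yes _ | no p | _ = no (λ e → p (nd-inj₂ e))
... | yes _ | yes _ | no p = no (λ e → p (nd-inj₃ e))

bnd-inj₁ : ∀ {l r l' r'} → BTree.nd l r ≡ nd l' r' → l ≡ l'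
bnd-inj₁ refl = refl
bnd-inj₂ : ∀ {l r l' r'} → BTree.nd l r ≡ nd l' r' → r ≡ r'
bnd-inj₂ refl = refl

_≟B_ : DecidableEquality BTree
lf ≟B lf = yes refl
lf ≟B nd _ _ = no (λ ())
nd _ _ ≟B lf = no (λ ())
nd l r ≟B nd l' r' with l ≟B l' | r ≟B r'
... | yes refl | yes refl = yes refl
... | no p | _ = no (λ e → p (bnd-inj₁ e))
... | yes _ | no p = no (λ e → p (bnd-inj₂ e))

_≟P_ : DecidableEquality (LTree × LTree)
_≟P_ = ≡-dec _≟T_ _≟T_

_≟Sh_ : DecidableEquality (BTree × BTree)
_≟Sh_ = ≡-dec _≟B_ _≟B_

insertions : ℕ → Word → List Word
insertions a [] = (a ∷ []) ∷ []
insertions a (b ∷ u) = (a ∷ b ∷ u) ∷ map (b ∷_) (insertions a u)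

perms : Word → List Word
perms [] = [] ∷ []
perms (a ∷ u) = concatMap (insertions a) (perms u)

splits : Word → List (Word × Word)
splits [] = ([] , []) ∷ []
splits (a ∷ u) = ([] , a ∷ u) ∷ map (λ p → a ∷ proj₁ p , proj₂ p) (splits u)

-- Elements of baxt are represented faithfully by their P-symbols
-- (s ≡ t in baxt iff P(s) ≡ P(t), by definition of ≡baxt).
-- Every pair (s,t) with st = w has representatives (x,y) with x ++ y ≡baxt w,
-- and then x ++ y has the same content as w, so x ++ y is a permutation of w.
-- Hence the pairs (s,t) ∈ baxt × baxt with st = w, Sh(P s) = U, Sh(P t) = V
-- are exactly the distinct values (P x , P y) below.
factorPairs : BTree × BTree → BTree × BTree → Word → List ((LTree × LTree) × (LTree × LTree))
factorPairs U V w =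
  deduplicate (≡-dec _≟P_ _≟P_)
    (map (λ p → P (proj₁ p) , P (proj₂ p))
      (filter (λ p → (P (proj₁ p ++ proj₂ p) ≟P P w)
                     ×-dec (Sh (P (proj₁ p)) ≟Sh U)
                     ×-dec (Sh (P (proj₂ p)) ≟Sh V))
        (concatMap splits (perms w))))

N : BTree × BTree → BTree × BTree → Word → ℕ
N U V w = length (factorPairs U V w)

{-# OPTIONS --safe #-}

-- Standardisation replaces w by the permutation std w w of 0 … n-1 that numbers equal letters from
-- left to right.  It keeps the relative order of any two positions, hence the shapes of both insertion
-- trees, so it sends the factorisations of w to factorisations of std w w, injectively since
-- destandardisation undoes it.  Conversely, destandardising a factorisation of std w w gives one of w:
-- equal letters of w occur in increasing order in std w w, and this is forced by its left tree alone,
-- so it holds throughout its Baxter class.  Hence N(w) = N(std w w).  Finally a P-symbol is determined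
-- by its shape and its content, and the content of std w w is 0 … n-1, so P(std w w) depends only on
-- Sh(P(w)).

module Submission where

open import Defs
open import Data.Nat using (ℕ; zero; suc; _+_; _≤_; _<_; z≤n; s≤s; z<s; _≤?_; _<?_; _≟_)
open import Data.Nat.Properties
  using ( ≤-refl; ≤-trans; ≤-antisym; <-irrefl; <-cmp; ≤-totalOrder; <-≤-trans; <⇒≤; <⇒≢; <⇒≱; <⇒≯
        ; ≤⇒≯; ≰⇒>; ≮⇒≥; m≤n⇒m<n∨m≡n; m<n⇒m<1+n; n<1+n; suc-injective; +-suc; +-comm; +-identityʳ
        ; m≤m+n; m<m+n; +-monoʳ-≤; +-monoʳ-<; +-cancelˡ-<; module ≤-Reasoning )
open import Data.Product using (_×_; _,_; proj₁; proj₂; ∃-syntax)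
import Data.Product as Product
open import Data.Product.Properties using (≡-dec)
open import Data.Sum using (inj₁; inj₂)
open import Data.Unit using (⊤; tt)
open import Data.List using (List; []; _∷_; _++_; [_]; length; map; filter; foldl; concatMap; upTo)
open import Data.List.Properties
  using (length-++; length-map; map-++; filter-++; filter-accept; filter-reject; filter-all; ∷-injective; upTo-∷ʳ)
import Data.List.Properties as List
open import Data.List.Extrema.Nat using (max; max-mono-⊆; max≈v⁺)
open import Data.List.Membership.Propositional using (_∈_; lose)
open import Data.List.Membership.Propositional.Properties
  using (∈-filter⁺; ∈-filter⁻; ∈-map⁺; ∈-map⁻; ∈-∃++; ∈-concatMap⁺)
open import Data.List.Relation.Unary.Any using (here; there)
import Data.List.Relation.Unary.Any.Properties as Any
open import Data.List.Relation.Unary.All as All using (All; []; _∷_)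
import Data.List.Relation.Unary.All.Properties as All
open import Data.List.Relation.Unary.AllPairs using (AllPairs; []; _∷_)
import Data.List.Relation.Unary.AllPairs.Properties as AllPairs
open import Data.List.Relation.Unary.Unique.Propositional using (Unique)
open import Data.List.Relation.Unary.Unique.DecPropositional.Properties using (deduplicate-!)
open import Data.List.Relation.Unary.Sorted.TotalOrder.Properties using (↗↭↗⇒≋; AllPairs⇒Sorted)
open import Data.List.Relation.Binary.Equality.Propositional using (≋⇒≡)
open import Data.List.Relation.Binary.Pointwise as Pointwise using (Pointwise; []; _∷_)
open import Data.List.Relation.Binary.Sublist.Propositional using (⊆-refl)
import Data.List.Relation.Binary.Sublist.Propositional.Properties as Sublist
open import Data.List.Relation.Binary.Permutation.Propositional as ↭
  using (_↭_; ↭-refl; ↭-sym; ↭-trans; ↭-reflexive; prep; swap; ↭⇒↭ₛ; module PermutationReasoning)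
open import Data.List.Relation.Binary.Permutation.Propositional.Properties
  using ( All-resp-↭; ∈-resp-↭; ↭-length; ↭-empty-inv; ++⁺ˡ; ++⁺ʳ; ++-identityʳ; ++-assoc; shift; drop-mid
        ; drop-∷; ∷↭∷ʳ; map⁺; filter-↭ )
open import Function using (_∘_; id; _⇔_; mk⇔; Equivalence)
import Function.Properties.Equivalence as ⇔
open import Relation.Binary.PropositionalEquality
  using (_≡_; _≢_; refl; sym; trans; cong; cong₂; subst; subst₂; module ≡-Reasoning)
open import Relation.Binary.Definitions using (tri<; tri≈; tri>)
open import Relation.Nullary using (¬_; yes; no; contradiction)
open import Relation.Nullary.Decidable using (_×-dec_)
open import Relation.Unary using (Decidable)

↭-shift-right : ∀ (xs : List ℕ) b {ys zs} a → zs ↭ a ∷ ys → xs ++ b ∷ zs ↭ a ∷ xs ++ b ∷ ys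
↭-shift-right xs b a p = ↭-trans (++⁺ˡ xs (↭-trans (prep b p) (swap b a ↭-refl))) (shift a xs (b ∷ _))

++-injective : ∀ {xs ys zs ws : List ℕ} → length xs ≡ length ys → xs ++ zs ≡ ys ++ ws → xs ≡ ys × zs ≡ ws
++-injective {[]}     {[]}     _   eq = refl , eq
++-injective {x ∷ xs} {y ∷ ys} len eq with ∷-injective eq
... | refl , eq′ = Product.map₁ (cong (x ∷_)) (++-injective (suc-injective len) eq′)

Pointwise-zip : ∀ {R S : ℕ → ℕ → Set} {u v} →
                Pointwise R u v → Pointwise S u v → Pointwise (λ c e → R c e × S c e) u v
Pointwise-zip [] [] = []
Pointwise-zip (r ∷ rs) (s ∷ ss) = (r , s) ∷ Pointwise-zip rs ss

Pointwise⇒map-≡ : ∀ {f : ℕ → ℕ} {z s} → Pointwise (λ a s → f s ≡ a) z s → map f s ≡ z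
Pointwise⇒map-≡ [] = refl
Pointwise⇒map-≡ (e ∷ es) = cong₂ _∷_ e (Pointwise⇒map-≡ es)

AllPairs-++⁻ : ∀ {R : ℕ → ℕ → Set} xs {ys} → AllPairs R (xs ++ ys) → AllPairs R xs × AllPairs R ys
AllPairs-++⁻ [] rs = [] , rs
AllPairs-++⁻ (x ∷ xs) (r ∷ rs) = Product.map₁ (All.++⁻ˡ xs r ∷_) (AllPairs-++⁻ xs rs)

max-split : ∀ c w → ∃[ a ] ∃[ w′ ] (c ∷ w ↭ w′ ++ [ a ]) × All (_≤ a) w′
max-split c [] = c , [] , ↭-refl , []
max-split c (c′ ∷ w) with max-split c′ w
... | a , w′ , p , w′≤a with c ≤? a
...   | yes c≤a = a , c ∷ w′ , prep c p , c≤a ∷ w′≤a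
...   | no c≰a  = c , w′ ++ [ a ] , ↭-trans (prep c p) (∷↭∷ʳ c (w′ ++ [ a ])) ,
                  All.++⁺ (All.map (λ x≤a → ≤-trans x≤a a≤c) w′≤a) (a≤c ∷ [])
  where a≤c = <⇒≤ (≰⇒> c≰a)

length-≤-by-injection : ∀ {A B : Set} (R : A → B → Set) {xs : List A} {ys : List B} → Unique xs →
  (∀ {x} → x ∈ xs → ∃[ y ] y ∈ ys × R x y) →
  (∀ {x x′ y} → x ∈ xs → x′ ∈ xs → R x y → R x′ y → x ≡ x′) →
  length xs ≤ length ys
length-≤-by-injection R [] _ _ = z≤n
length-≤-by-injection R {x ∷ xs} (x∉xs ∷ uniq) total inj with total (here refl)
... | y , y∈ys , Rxy with ∈-∃++ y∈ys
... | ys₁ , ys₂ , refl = begin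
  suc (length xs)           ≤⟨ s≤s (length-≤-by-injection R uniq total′ λ m m′ → inj (there m) (there m′)) ⟩
  suc (length (ys₁ ++ ys₂)) ≡⟨ ↭-length (shift y ys₁ ys₂) ⟨
  length (ys₁ ++ y ∷ ys₂)   ∎
  where
  open ≤-Reasoning
  total′ : ∀ {x′} → x′ ∈ xs → ∃[ y′ ] y′ ∈ ys₁ ++ ys₂ × R x′ y′
  total′ x′∈xs with total (there x′∈xs)
  ... | y′ , y′∈ys , Rx′y′ with ∈-resp-↭ (shift y ys₁ ys₂) y′∈ys
  ...   | here refl = contradiction (inj (here refl) (there x′∈xs) Rxy Rx′y′) (All.lookup x∉xs x′∈xs)
  ...   | there y′∈ = y′ , y′∈ , Rx′y′

count : {P : ℕ → Set} → Decidable P → Word → ℕ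
count P? = length ∘ filter P?

count-↭ : ∀ {P} (P? : Decidable P) {u v} → u ↭ v → count P? u ≡ count P? v
count-↭ P? = ↭-length ∘ filter-↭ P?

count-++ : ∀ {P} (P? : Decidable P) u v → count P? (u ++ v) ≡ count P? u + count P? v
count-++ P? u v = trans (cong length (filter-++ P? u v)) (length-++ (filter P? u))

count-accept : ∀ {P} (P? : Decidable P) {c w} → P c → count P? (c ∷ w) ≡ suc (count P? w)
count-accept P? Pc = cong length (filter-accept P? Pc)

count-reject : ∀ {P} (P? : Decidable P) {c w} → ¬ P c → count P? (c ∷ w) ≡ count P? w
count-reject P? ¬Pc = cong length (filter-reject P? ¬Pc)

below : ℕ → Word → ℕ
below a = count (_<? a)

occ : ℕ → Word → ℕ
occ a = count (_≟ a)

below-suc : ∀ a w → below (suc a) w ≡ below a w + occ a w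
below-suc a [] = refl
below-suc a (c ∷ w) with <-cmp c a
... | tri< c<a c≢a _ = begin
  below (suc a) (c ∷ w)           ≡⟨ count-accept (_<? suc a) (m<n⇒m<1+n c<a) ⟩
  suc (below (suc a) w)           ≡⟨ cong suc (below-suc a w) ⟩
  suc (below a w + occ a w)       ≡⟨ cong₂ _+_ (count-accept (_<? a) c<a) (count-reject (_≟ a) c≢a) ⟨
  below a (c ∷ w) + occ a (c ∷ w) ∎
  where open ≡-Reasoning
... | tri≈ c≮a refl _ = begin
  below (suc c) (c ∷ w)           ≡⟨ count-accept (_<? suc c) ≤-refl ⟩
  suc (below (suc c) w)           ≡⟨ cong suc (below-suc c w) ⟩
  suc (below c w + occ c w)       ≡⟨ +-suc _ _ ⟨
  below c w + suc (occ c w)       ≡⟨ cong₂ _+_ (count-reject (_<? c) c≮a) (count-accept (_≟ c) refl) ⟨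
  below c (c ∷ w) + occ c (c ∷ w) ∎
  where open ≡-Reasoning
... | tri> _ c≢a c>a = begin
  below (suc a) (c ∷ w)           ≡⟨ count-reject (_<? suc a) (<⇒≱ (s≤s c>a)) ⟩
  below (suc a) w                 ≡⟨ below-suc a w ⟩
  below a w + occ a w             ≡⟨ cong₂ _+_ (count-reject (_<? a) (<⇒≯ c>a)) (count-reject (_≟ a) c≢a) ⟨
  below a (c ∷ w) + occ a (c ∷ w) ∎
  where open ≡-Reasoning

below-mono : ∀ {a b} → a ≤ b → ∀ w → below a w ≤ below b w
below-mono {a} {b} a≤b w = Sublist.length-mono-≤
  (Sublist.filter⁺ (_<? a) (_<? b) (λ { refl c<a → <-≤-trans c<a a≤b }) (⊆-refl {x = w}))

below-all≤ : ∀ {a w} → All (_≤ a) w → below (suc a) w ≡ length w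
below-all≤ w≤a = cong length (filter-all (_<? suc _) (All.map s≤s w≤a))

below-drop-max : ∀ {x a w w′} → x ≤ a → w ↭ w′ ++ [ a ] → below x w ≡ below x w′
below-drop-max {x} {a} {w} {w′} x≤a p = begin
  below x w                  ≡⟨ count-↭ (_<? x) p ⟩
  below x (w′ ++ [ a ])      ≡⟨ count-++ (_<? x) w′ [ a ] ⟩
  below x w′ + below x [ a ] ≡⟨ cong (below x w′ +_) (count-reject (_<? x) (≤⇒≯ x≤a)) ⟩
  below x w′ + 0             ≡⟨ +-identityʳ _ ⟩
  below x w′                 ∎
  where open ≡-Reasoning

occ-∷ʳ-≡ : ∀ a p → occ a (p ++ [ a ]) ≡ suc (occ a p)
occ-∷ʳ-≡ a p = begin
  occ a (p ++ [ a ])      ≡⟨ count-++ (_≟ a) p [ a ] ⟩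
  occ a p + occ a [ a ]   ≡⟨ cong (occ a p +_) (count-accept (_≟ a) refl) ⟩
  occ a p + 1             ≡⟨ +-comm (occ a p) 1 ⟩
  suc (occ a p)           ∎
  where open ≡-Reasoning

occ-∷ʳ-≢ : ∀ {a b} p → a ≢ b → occ b (p ++ [ a ]) ≡ occ b p
occ-∷ʳ-≢ {a} {b} p a≢b = begin
  occ b (p ++ [ a ])      ≡⟨ count-++ (_≟ b) p [ a ] ⟩
  occ b p + occ b [ a ]   ≡⟨ cong (occ b p +_) (count-reject (_≟ b) a≢b) ⟩
  occ b p + 0             ≡⟨ +-identityʳ _ ⟩
  occ b p                 ∎
  where open ≡-Reasoning

occ-∷ʳ-≤ : ∀ a e p → occ e p ≤ occ e (p ++ [ a ])
occ-∷ʳ-≤ a e p = subst (occ e p ≤_) (sym (count-++ (_≟ e) p [ a ])) (m≤m+n (occ e p) _)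

occ-prefix-< : ∀ {a w} p rest → p ++ a ∷ rest ↭ w → occ a p < occ a w
occ-prefix-< {a} {w} p rest p↭w = begin-strict
  occ a p                    <⟨ m<m+n (occ a p) z<s ⟩
  occ a p + suc (occ a rest) ≡⟨ cong (occ a p +_) (count-accept (_≟ a) refl) ⟨
  occ a p + occ a (a ∷ rest) ≡⟨ count-++ (_≟ a) p (a ∷ rest) ⟨
  occ a (p ++ a ∷ rest)      ≡⟨ count-↭ (_≟ a) p↭w ⟩
  occ a w                    ∎
  where open ≤-Reasoning

occ-pos⇒∈ : ∀ {a w} → 0 < occ a w → a ∈ w
occ-pos⇒∈ {a} {w} pos with filter (_≟ a) w in eq
... | x ∷ _ with ∈-filter⁻ (_≟ a) {xs = w} (subst (x ∈_) (sym eq) (here refl))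
...   | x∈w , refl = x∈w

-- Binary search trees and P-symbols

inorder : LTree → List ℕ
inorder lf = []
inorder (nd l b r) = inorder l ++ b ∷ inorder r

inorder-insR : ∀ a t → inorder (insR a t) ↭ a ∷ inorder t
inorder-insR a lf = ↭-refl
inorder-insR a (nd l b r) with a ≤? b
... | yes _ = ++⁺ʳ (b ∷ inorder r) (inorder-insR a l)
... | no _  = ↭-shift-right (inorder l) b a (inorder-insR a r)

inorder-insL : ∀ a t → inorder (insL a t) ↭ a ∷ inorder t
inorder-insL a lf = ↭-refl
inorder-insL a (nd l b r) with a <? b
... | yes _ = ++⁺ʳ (b ∷ inorder r) (inorder-insL a l)
... | no _  = ↭-shift-right (inorder l) b a (inorder-insL a r)

inorder-rtree : ∀ z → inorder (rtree z) ↭ z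
inorder-rtree [] = ↭-refl
inorder-rtree (a ∷ z) = ↭-trans (inorder-insR a (rtree z)) (prep a (inorder-rtree z))

inorder-foldl-insL : ∀ t z → inorder (foldl (λ t a → insL a t) t z) ↭ z ++ inorder t
inorder-foldl-insL t [] = ↭-refl
inorder-foldl-insL t (a ∷ z) = ↭-trans (inorder-foldl-insL (insL a t) z)
  (↭-trans (++⁺ˡ z (inorder-insL a t)) (shift a z (inorder t)))

inorder-ltree : ∀ z → inorder (ltree z) ↭ z
inorder-ltree z = ↭-trans (inorder-foldl-insL lf z) (++-identityʳ z)

BST : LTree → Set
BST lf = ⊤
BST (nd l b r) = BST l × All (_≤ b) (inorder l) × All (b ≤_) (inorder r) × BST r

insR-BST : ∀ a t → BST t → BST (insR a t)
insR-BST a lf _ = tt , [] , [] , tt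
insR-BST a (nd l b r) (l-bst , l≤b , b≤r , r-bst) with a ≤? b
... | yes a≤b = insR-BST a l l-bst , All-resp-↭ (↭-sym (inorder-insR a l)) (a≤b ∷ l≤b) , b≤r , r-bst
... | no a≰b  =
  l-bst , l≤b , All-resp-↭ (↭-sym (inorder-insR a r)) (<⇒≤ (≰⇒> a≰b) ∷ b≤r) , insR-BST a r r-bst

insL-BST : ∀ a t → BST t → BST (insL a t)
insL-BST a lf _ = tt , [] , [] , tt
insL-BST a (nd l b r) (l-bst , l≤b , b≤r , r-bst) with a <? b
... | yes a<b = insL-BST a l l-bst , All-resp-↭ (↭-sym (inorder-insL a l)) (<⇒≤ a<b ∷ l≤b) , b≤r , r-bst
... | no a≮b  = l-bst , l≤b , All-resp-↭ (↭-sym (inorder-insL a r)) (≮⇒≥ a≮b ∷ b≤r) , insL-BST a r r-bst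

rtree-BST : ∀ z → BST (rtree z)
rtree-BST [] = tt
rtree-BST (a ∷ z) = insR-BST a (rtree z) (rtree-BST z)

foldl-insL-BST : ∀ t z → BST t → BST (foldl (λ t a → insL a t) t z)
foldl-insL-BST t [] t-bst = t-bst
foldl-insL-BST t (a ∷ z) t-bst = foldl-insL-BST (insL a t) z (insL-BST a t t-bst)

ltree-BST : ∀ z → BST (ltree z)
ltree-BST z = foldl-insL-BST lf z tt

Sorted : List ℕ → Set
Sorted = AllPairs _≤_

BST⇒sorted : ∀ t → BST t → Sorted (inorder t)
BST⇒sorted lf _ = []
BST⇒sorted (nd l b r) (l-bst , l≤b , b≤r , r-bst) =
  AllPairs.++⁺ (BST⇒sorted l l-bst) (b≤r ∷ BST⇒sorted r r-bst)
    (All.map (λ x≤b → x≤b ∷ All.map (≤-trans x≤b) b≤r) l≤b)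

sorted-↭⇒≡ : ∀ {xs ys} → Sorted xs → Sorted ys → xs ↭ ys → xs ≡ ys
sorted-↭⇒≡ xs↗ ys↗ p = ≋⇒≡ (↗↭↗⇒≋ ≤-totalOrder
  (AllPairs⇒Sorted ≤-totalOrder xs↗) (AllPairs⇒Sorted ≤-totalOrder ys↗) (↭⇒↭ₛ p))

size : BTree → ℕ
size lf = 0
size (nd l r) = size l + suc (size r)

length-inorder : ∀ t → length (inorder t) ≡ size (shape t)
length-inorder lf = refl
length-inorder (nd l b r) =
  trans (length-++ (inorder l)) (cong₂ (λ m n → m + suc n) (length-inorder l) (length-inorder r))

shape-inorder-injective : ∀ t u → shape t ≡ shape u → inorder t ≡ inorder u → t ≡ u
shape-inorder-injective lf lf _ _ = refl
shape-inorder-injective lf (nd _ _ _) () _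
shape-inorder-injective (nd _ _ _) lf () _
shape-inorder-injective (nd l b r) (nd l′ b′ r′) sh eq with ++-injective {inorder l} {inorder l′} length-eq eq
  where
  length-eq = trans (length-inorder l) (trans (cong size (bnd-inj₁ sh)) (sym (length-inorder l′)))
... | eqˡ , eq′ with ∷-injective eq′
...   | refl , eqʳ = cong₂ (λ x y → nd x b y)
  (shape-inorder-injective l l′ (bnd-inj₁ sh) eqˡ) (shape-inorder-injective r r′ (bnd-inj₂ sh) eqʳ)

BST-≡ : ∀ {t u} → BST t → BST u → inorder t ↭ inorder u → shape t ≡ shape u → t ≡ u
BST-≡ {t} {u} t-bst u-bst p sh =
  shape-inorder-injective t u sh (sorted-↭⇒≡ (BST⇒sorted t t-bst) (BST⇒sorted u u-bst) p)

P-≡ : ∀ {u v} → u ↭ v → Sh (P u) ≡ Sh (P v) → P u ≡ P v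
P-≡ {u} {v} p sh = cong₂ _,_
  (BST-≡ (ltree-BST u) (ltree-BST v) (↭-trans (inorder-ltree u) (↭-trans p (↭-sym (inorder-ltree v))))
         (cong proj₁ sh))
  (BST-≡ (rtree-BST u) (rtree-BST v) (↭-trans (inorder-rtree u) (↭-trans p (↭-sym (inorder-rtree v))))
         (cong proj₂ sh))

P-↭ : ∀ {u v} → P u ≡ P v → u ↭ v
P-↭ {u} {v} eq =
  ↭-trans (↭-sym (inorder-rtree u)) (↭-trans (↭-reflexive (cong (inorder ∘ proj₂) eq)) (inorder-rtree v))

P-≡-by-retraction : ∀ (f : ℕ → ℕ) {x₁ x₂ s₁ s₂} → map f s₁ ≡ x₁ → map f s₂ ≡ x₂ →
                    P s₁ ≡ P s₂ → Sh (P x₁) ≡ Sh (P x₂) → P x₁ ≡ P x₂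
P-≡-by-retraction f {s₁ = s₁} {s₂} refl refl Ps sh = P-≡ (map⁺ f (P-↭ {s₁} {s₂} Ps)) sh

length-Sh : ∀ w → length w ≡ size (proj₂ (Sh (P w)))
length-Sh w = trans (↭-length (↭-sym (inorder-rtree w))) (length-inorder (rtree w))

SameCmp : ℕ → ℕ → ℕ → ℕ → Set
SameCmp a b c e = (a ≤ c) ⇔ (b ≤ e)

-- u_i ≤ u_j ⇔ v_i ≤ v_j for i < j only.  This one-sided test is exactly the comparison made by both
-- insertions, and it survives standardisation, which replaces a tie u_i = u_j by v_i < v_j.
data SameOrder : Word → Word → Set where
  []  : SameOrder [] []
  _∷_ : ∀ {a b u v} → Pointwise (SameCmp a b) u v → SameOrder u v → SameOrder (a ∷ u) (b ∷ v)

SameOrder-sym : ∀ {u v} → SameOrder u v → SameOrder v u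
SameOrder-sym [] = []
SameOrder-sym (cmp ∷ so) = Pointwise.symmetric ⇔.sym cmp ∷ SameOrder-sym so

SameOrder-trans : ∀ {u v x} → SameOrder u v → SameOrder v x → SameOrder u x
SameOrder-trans [] [] = []
SameOrder-trans (cmp ∷ so) (cmp′ ∷ so′) = Pointwise.transitive ⇔.trans cmp cmp′ ∷ SameOrder-trans so so′

data TreePointwise (R : ℕ → ℕ → Set) : LTree → LTree → Set where
  lf : TreePointwise R lf lf
  nd : ∀ {l c r l′ e r′} → TreePointwise R l l′ → R c e → TreePointwise R r r′ →
       TreePointwise R (nd l c r) (nd l′ e r′)

TreePointwise-map : ∀ {R S} → (∀ {c e} → R c e → S c e) →
                    ∀ {t t′} → TreePointwise R t t′ → TreePointwise S t t′
TreePointwise-map f lf = lf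
TreePointwise-map f (nd l rce r) = nd (TreePointwise-map f l) (f rce) (TreePointwise-map f r)

TreePointwise⇒shape : ∀ {R t t′} → TreePointwise R t t′ → shape t ≡ shape t′
TreePointwise⇒shape lf = refl
TreePointwise⇒shape (nd l _ r) = cong₂ nd (TreePointwise⇒shape l) (TreePointwise⇒shape r)

insR-pointwise : ∀ {R a b t t′} → R a b → TreePointwise (λ c e → SameCmp a b c e × R c e) t t′ →
                 TreePointwise R (insR a t) (insR b t′)
insR-pointwise rab lf = nd lf rab lf
insR-pointwise {a = a} {b} rab (nd {c = c} {e = e} l (cmp , rce) r) with a ≤? c | b ≤? e
... | yes _   | yes _   = nd (insR-pointwise rab l) rce (TreePointwise-map proj₂ r)
... | no _    | no _    = nd (TreePointwise-map proj₂ l) rce (insR-pointwise rab r)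
... | yes a≤c | no b≰e  = contradiction (Equivalence.to cmp a≤c) b≰e
... | no a≰c  | yes b≤e = contradiction (Equivalence.from cmp b≤e) a≰c

insL-pointwise : ∀ {R a b t t′} → R a b → TreePointwise (λ c e → SameCmp c e a b × R c e) t t′ →
                 TreePointwise R (insL a t) (insL b t′)
insL-pointwise rab lf = nd lf rab lf
insL-pointwise {a = a} {b} rab (nd {c = c} {e = e} l (cmp , rce) r) with a <? c | b <? e
... | yes _   | yes _   = nd (insL-pointwise rab l) rce (TreePointwise-map proj₂ r)
... | no _    | no _    = nd (TreePointwise-map proj₂ l) rce (insL-pointwise rab r)
... | yes a<c | no b≮e  = contradiction (Equivalence.from cmp (≮⇒≥ b≮e)) (<⇒≱ a<c)
... | no a≮c  | yes b<e = contradiction (Equivalence.to cmp (≮⇒≥ a≮c)) (<⇒≱ b<e)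

rtree-pointwise : ∀ {R u v} → SameOrder u v → Pointwise R u v → TreePointwise R (rtree u) (rtree v)
rtree-pointwise [] [] = lf
rtree-pointwise (cmp ∷ so) (rab ∷ rs) = insR-pointwise rab (rtree-pointwise so (Pointwise-zip cmp rs))

foldl-insL-pointwise : ∀ {R u v t t′} → SameOrder u v → Pointwise R u v →
  TreePointwise (λ c e → Pointwise (SameCmp c e) u v × R c e) t t′ →
  TreePointwise R (foldl (λ t a → insL a t) t u) (foldl (λ t a → insL a t) t′ v)
foldl-insL-pointwise [] [] tp = TreePointwise-map proj₂ tp
foldl-insL-pointwise (cmp ∷ so) (rab ∷ rs) tp = foldl-insL-pointwise so rs
  (insL-pointwise (cmp , rab) (TreePointwise-map (λ { (c ∷ cs , rce) → c , cs , rce }) tp))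

SameOrder⇒Pointwise : ∀ {u v} → SameOrder u v → Pointwise (λ _ _ → ⊤) u v
SameOrder⇒Pointwise [] = []
SameOrder⇒Pointwise (_ ∷ so) = tt ∷ SameOrder⇒Pointwise so

SameOrder⇒Sh : ∀ {u v} → SameOrder u v → Sh (P u) ≡ Sh (P v)
SameOrder⇒Sh so = cong₂ _,_
  (TreePointwise⇒shape (foldl-insL-pointwise so (SameOrder⇒Pointwise so) lf))
  (TreePointwise⇒shape (rtree-pointwise so (SameOrder⇒Pointwise so)))

below-Pointwise : ∀ {a b u v} → Pointwise (SameCmp a b) u v → below a u ≡ below b v
below-Pointwise [] = refl
below-Pointwise {a} {b} {c ∷ u} {e ∷ v} (cmp ∷ cmps) with c <? a | e <? b
... | yes c<a | yes e<b =
  trans (count-accept (_<? a) c<a) (trans (cong suc (below-Pointwise cmps)) (sym (count-accept (_<? b) e<b)))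
... | no c≮a  | no e≮b  =
  trans (count-reject (_<? a) c≮a) (trans (below-Pointwise cmps) (sym (count-reject (_<? b) e≮b)))
... | yes c<a | no e≮b  = contradiction (Equivalence.from cmp (≮⇒≥ e≮b)) (<⇒≱ c<a)
... | no c≮a  | yes e<b = contradiction (Equivalence.to cmp (≮⇒≥ c≮a)) (<⇒≱ e<b)

below-head-≡ : ∀ {a b u v} → a ∷ u ↭ b ∷ v → Pointwise (SameCmp a b) u v →
               below a (a ∷ u) ≡ below b (a ∷ u)
below-head-≡ {a} {b} {u} {v} p cmp = begin
  below a (a ∷ u) ≡⟨ count-reject (_<? a) (<-irrefl refl) ⟩
  below a u       ≡⟨ below-Pointwise cmp ⟩
  below b v       ≡⟨ count-reject (_<? b) (<-irrefl refl) ⟨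
  below b (b ∷ v) ≡⟨ count-↭ (_<? b) p ⟨
  below b (a ∷ u) ∎
  where open ≡-Reasoning

below-head-< : ∀ {a b} u → a < b → below a (a ∷ u) < below b (a ∷ u)
below-head-< {a} {b} u a<b = begin-strict
  below a (a ∷ u)                 <⟨ m<m+n _ (subst (0 <_) (sym (count-accept (_≟ a) refl)) z<s) ⟩
  below a (a ∷ u) + occ a (a ∷ u) ≡⟨ below-suc a (a ∷ u) ⟨
  below (suc a) (a ∷ u)           ≤⟨ below-mono a<b (a ∷ u) ⟩
  below b (a ∷ u)                 ∎
  where open ≤-Reasoning

SameOrder-↭⇒≡ : ∀ {u v} → u ↭ v → SameOrder u v → u ≡ v
SameOrder-↭⇒≡ {[]} {[]} _ [] = refl
SameOrder-↭⇒≡ {a ∷ u} {b ∷ v} p (cmp ∷ so) with <-cmp a b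
... | tri≈ _ refl _ = cong (a ∷_) (SameOrder-↭⇒≡ (drop-∷ p) so)
... | tri< a<b _ _  = contradiction (below-head-≡ p cmp) (<⇒≢ (below-head-< u a<b))
... | tri> _ _ b<a  =
  contradiction (below-head-≡ (↭-sym p) (Pointwise.symmetric ⇔.sym cmp)) (<⇒≢ (below-head-< v b<a))

-- Standardisation

-- The k-th occurrence of a letter a in p ++ z (counting from 0) is numbered below a w + k.
stdFrom : Word → Word → Word → Word
stdFrom w p [] = []
stdFrom w p (a ∷ z) = below a w + occ a p ∷ stdFrom w (p ++ [ a ]) z

std : Word → Word → Word
std w = stdFrom w []

length-stdFrom : ∀ w p z → length (stdFrom w p z) ≡ length z
length-stdFrom w p [] = refl
length-stdFrom w p (a ∷ z) = cong suc (length-stdFrom w (p ++ [ a ]) z)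

stdFrom-++ : ∀ w p x y → stdFrom w p (x ++ y) ≡ stdFrom w p x ++ stdFrom w (p ++ x) y
stdFrom-++ w p [] y = cong (λ p′ → stdFrom w p′ y) (sym (List.++-identityʳ p))
stdFrom-++ w p (a ∷ x) y = cong (below a w + occ a p ∷_) (trans (stdFrom-++ w (p ++ [ a ]) x y)
  (cong (λ p′ → stdFrom w (p ++ [ a ]) x ++ stdFrom w p′ y) (List.++-assoc p [ a ] x)))

stdFrom-resp-↭ : ∀ w {p p′} z → p ↭ p′ → stdFrom w p z ≡ stdFrom w p′ z
stdFrom-resp-↭ w [] _ = refl
stdFrom-resp-↭ w (a ∷ z) p↭p′ =
  cong₂ (λ k → below a w + k ∷_) (count-↭ (_≟ a) p↭p′) (stdFrom-resp-↭ w z (++⁺ʳ [ a ] p↭p′))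

stdFrom-↭ : ∀ w p {z z′} → z ↭ z′ → stdFrom w p z ↭ stdFrom w p z′
stdFrom-↭ w p ↭.refl = ↭-refl
stdFrom-↭ w p (↭.prep a z↭z′) = prep _ (stdFrom-↭ w (p ++ [ a ]) z↭z′)
stdFrom-↭ w p (↭.trans z↭z′ z′↭z″) = ↭-trans (stdFrom-↭ w p z↭z′) (stdFrom-↭ w p z′↭z″)
stdFrom-↭ w p (↭.swap {z} {z′} a b z↭z′) with a ≟ b
... | yes refl = prep _ (prep _ (stdFrom-↭ w ((p ++ [ a ]) ++ [ a ]) z↭z′))
... | no a≢b = begin
  α ∷ below b w + occ b (p ++ [ a ]) ∷ stdFrom w pab z
    ≡⟨ cong (λ k → α ∷ below b w + k ∷ stdFrom w pab z) (occ-∷ʳ-≢ p a≢b) ⟩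
  α ∷ β ∷ stdFrom w pab z
    ↭⟨ swap α β (stdFrom-↭ w pab z↭z′) ⟩
  β ∷ α ∷ stdFrom w pab z′
    ≡⟨ cong₂ (λ k rest → β ∷ below a w + k ∷ rest)
             (occ-∷ʳ-≢ p (a≢b ∘ sym)) (stdFrom-resp-↭ w z′ pba↭pab) ⟨
  β ∷ below a w + occ a (p ++ [ b ]) ∷ stdFrom w pba z′
    ∎
  where
  open PermutationReasoning
  α = below a w + occ a p
  β = below b w + occ b p
  pab = (p ++ [ a ]) ++ [ b ]
  pba = (p ++ [ b ]) ++ [ a ]
  pba↭pab : pba ↭ pab
  pba↭pab = ↭-trans (++-assoc p [ b ] [ a ])
              (↭-trans (++⁺ˡ p (swap b a ↭-refl)) (↭-sym (++-assoc p [ a ] [ b ])))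

↭-shift-prefix : ∀ {a} {w : Word} p z q → p ++ (a ∷ z) ++ q ↭ w → (p ++ [ a ]) ++ z ++ q ↭ w
↭-shift-prefix {a} p z q = ↭-trans (↭-reflexive (List.++-assoc p [ a ] (z ++ q)))

StdBlock : Word → Word → ℕ → ℕ → Set
StdBlock w p a s = below a w + occ a p ≤ s × s < below (suc a) w

stdFrom-block : ∀ w p z q → p ++ z ++ q ↭ w → Pointwise (StdBlock w p) z (stdFrom w p z)
stdFrom-block w p [] q _ = []
stdFrom-block w p (a ∷ z) q p↭w =
  (≤-refl , head<) ∷ Pointwise.map weaken (stdFrom-block w (p ++ [ a ]) z q (↭-shift-prefix p z q p↭w))
  where
  head< : below a w + occ a p < below (suc a) w
  head< = subst (below a w + occ a p <_) (sym (below-suc a w))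
                (+-monoʳ-< (below a w) (occ-prefix-< p (z ++ q) p↭w))
  weaken : ∀ {e s} → StdBlock w (p ++ [ a ]) e s → StdBlock w p e s
  weaken {e} (lo , hi) = ≤-trans (+-monoʳ-≤ (below e w) (occ-∷ʳ-≤ a e p)) lo , hi

stdFrom-SameOrder : ∀ w p z q → p ++ z ++ q ↭ w → SameOrder z (stdFrom w p z)
stdFrom-SameOrder w p [] q _ = []
stdFrom-SameOrder w p (a ∷ z) q p↭w with stdFrom-block w p (a ∷ z) q p↭w
... | (_ , head<) ∷ _ = Pointwise.map cmp (stdFrom-block w (p ++ [ a ]) z q p′↭w) ∷
                        stdFrom-SameOrder w (p ++ [ a ]) z q p′↭w
  where
  p′↭w = ↭-shift-prefix p z q p↭w
  v = below a w + occ a p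
  cmp : ∀ {e s} → StdBlock w (p ++ [ a ]) e s → SameCmp a v e s
  cmp {e} {s} (lo , hi) = mk⇔ to from
    where
    to : a ≤ e → v ≤ s
    to a≤e with m≤n⇒m<n∨m≡n a≤e
    ... | inj₁ a<e  = <⇒≤ (<-≤-trans head< (≤-trans (below-mono a<e w) (≤-trans (m≤m+n _ _) lo)))
    ... | inj₂ refl = <⇒≤ (<-≤-trans (+-monoʳ-< (below a w) (n<1+n (occ a p)))
                                      (subst (λ k → below a w + k ≤ s) (occ-∷ʳ-≡ a p) lo))
    from : v ≤ s → a ≤ e
    from v≤s = ≮⇒≥ (λ e<a → <⇒≱ (<-≤-trans hi (below-mono e<a w)) (≤-trans (m≤m+n _ _) v≤s))

std-SameOrder : ∀ {w z} → z ↭ w → SameOrder z (std w z)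
std-SameOrder {w} {z} p = stdFrom-SameOrder w [] z [] (↭-trans (++-identityʳ z) p)

stdFrom-cong : ∀ {w w′} p z → All (λ c → below c w ≡ below c w′) z → stdFrom w p z ≡ stdFrom w′ p z
stdFrom-cong p [] [] = refl
stdFrom-cong p (a ∷ z) (eq ∷ eqs) = cong₂ (λ k → k + occ a p ∷_) eq (stdFrom-cong (p ++ [ a ]) z eqs)

std-↭-upTo : ∀ n w → length w ≡ n → std w w ↭ upTo n
std-↭-upTo zero [] _ = ↭-refl
std-↭-upTo (suc n) (c ∷ w) len with max-split c w
... | a , w′ , p , w′≤a = begin
  std W W                              ↭⟨ stdFrom-↭ W [] p ⟩
  std W (w′ ++ [ a ])                  ≡⟨ stdFrom-++ W [] w′ [ a ] ⟩
  std W w′ ++ [ below a W + occ a w′ ] ≡⟨ cong₂ (λ z k → z ++ [ k ]) (stdFrom-cong [] w′ below-W) last ⟩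
  std w′ w′ ++ [ n ]                   ↭⟨ ++⁺ʳ [ n ] (std-↭-upTo n w′ len′) ⟩
  upTo n ++ [ n ]                      ≡⟨ upTo-∷ʳ n ⟩
  upTo (suc n)                         ∎
  where
  open PermutationReasoning
  W = c ∷ w
  below-W : All (λ x → below x W ≡ below x w′) w′
  below-W = All.map (λ x≤a → below-drop-max x≤a p) w′≤a
  len′ : length w′ ≡ n
  len′ = suc-injective
    (trans (+-comm 1 (length w′)) (trans (sym (length-++ w′)) (trans (sym (↭-length p)) len)))
  last : below a W + occ a w′ ≡ n
  last = trans (cong (_+ occ a w′) (below-drop-max ≤-refl p))
               (trans (sym (below-suc a w′)) (trans (below-all≤ w′≤a) len′))

destd : Word → ℕ → ℕ
destd w k = max 0 (filter (λ c → below c w ≤? k) w)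

destd-mono : ∀ w {k k′} → k ≤ k′ → destd w k ≤ destd w k′
destd-mono w {k} {k′} k≤k′ = max-mono-⊆ z≤n λ c∈ →
  let c∈w , lo = ∈-filter⁻ (λ c → below c w ≤? k) {xs = w} c∈
  in ∈-filter⁺ (λ c → below c w ≤? k′) c∈w (≤-trans lo k≤k′)

InBlock : Word → ℕ → ℕ → Set
InBlock w a k = below a w ≤ k × k < below (suc a) w

destd-block : ∀ w {a k} → InBlock w a k → destd w k ≡ a
destd-block w {a} {k} (lo , hi) = max≈v⁺ (∈-filter⁺ (λ c → below c w ≤? k) a∈w lo) (All.tabulate ≤a) z≤n
  where
  a∈w : a ∈ w
  a∈w = occ-pos⇒∈ (+-cancelˡ-< (below a w) 0 (occ a w) (begin-strict
    below a w + 0       ≡⟨ +-identityʳ _ ⟩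
    below a w           ≤⟨ lo ⟩
    k                   <⟨ hi ⟩
    below (suc a) w     ≡⟨ below-suc a w ⟩
    below a w + occ a w ∎))
    where open ≤-Reasoning
  ≤a : ∀ {c} → c ∈ filter (λ c → below c w ≤? k) w → c ≤ a
  ≤a c∈ = ≮⇒≥ λ a<c →
    <⇒≱ (<-≤-trans hi (below-mono a<c w)) (proj₂ (∈-filter⁻ (λ c → below c w ≤? k) {xs = w} c∈))

destd-stdFrom : ∀ w p z q → p ++ z ++ q ↭ w → map (destd w) (stdFrom w p z) ≡ z
destd-stdFrom w p z q p↭w = Pointwise⇒map-≡
  (Pointwise.map (λ (lo , hi) → destd-block w (≤-trans (m≤m+n _ _) lo , hi)) (stdFrom-block w p z q p↭w))

destd-std : ∀ {w z} → z ↭ w → map (destd w) (std w z) ≡ z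
destd-std {w} {z} p = destd-stdFrom w [] z [] (↭-trans (++-identityʳ z) p)

-- Separated inversions

-- For the destandardisation d of w, Separated (std w w) says that equal letters of w are numbered from
-- left to right.  LeftSeparated shows that this property is read off the left tree alone, so it passes
-- to every word in the Baxter class of std w w, where it makes d preserve the relative order.
module Separation (d : ℕ → ℕ) (d-mono : ∀ {x y} → x ≤ y → d x ≤ d y) where

  Separates : ℕ → ℕ → Set
  Separates c e = e < c → d e < d c

  Separated : Word → Set
  Separated = AllPairs Separates

  LeftSeparated : LTree → Set
  LeftSeparated lf = ⊤
  LeftSeparated (nd l b r) = LeftSeparated l × All (λ c → d c < d b) (inorder l) × LeftSeparated r

  Separated⇒SameOrder : ∀ {y} → Separated y → SameOrder y (map d y)
  Separated⇒SameOrder [] = []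
  Separated⇒SameOrder (sep ∷ seps) = pointwise sep ∷ Separated⇒SameOrder seps
    where
    pointwise : ∀ {a y} → All (Separates a) y → Pointwise (SameCmp a (d a)) y (map d y)
    pointwise [] = []
    pointwise (s ∷ ss) = mk⇔ d-mono (λ da≤de → ≮⇒≥ (λ e<a → <⇒≱ (s e<a) da≤de)) ∷ pointwise ss

  SameOrder⇒Separated : ∀ {y} → SameOrder y (map d y) → Separated y
  SameOrder⇒Separated {[]} [] = []
  SameOrder⇒Separated {_ ∷ _} (cmp ∷ so) = all cmp ∷ SameOrder⇒Separated so
    where
    all : ∀ {a y} → Pointwise (SameCmp a (d a)) y (map d y) → All (Separates a) y
    all {y = []} [] = []
    all {y = _ ∷ _} (c ∷ cs) = (λ e<a → ≰⇒> (λ da≤de → <⇒≱ e<a (Equivalence.from c da≤de))) ∷ all cs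

  insL-LeftSeparated : ∀ c t → LeftSeparated t → All (λ b → Separates b c) (inorder t) →
                       LeftSeparated (insL c t)
  insL-LeftSeparated c lf _ _ = tt , [] , tt
  insL-LeftSeparated c (nd l b r) (sl , l<b , sr) sep with All.++⁻ (inorder l) sep | c <? b
  ... | sepˡ , sepᵇ ∷ _ | yes c<b =
    insL-LeftSeparated c l sl sepˡ , All-resp-↭ (↭-sym (inorder-insL c l)) (sepᵇ c<b ∷ l<b) , sr
  ... | _ , _ ∷ sepʳ | no _ = sl , l<b , insL-LeftSeparated c r sr sepʳ

  foldl-insL-LeftSeparated : ∀ t y → LeftSeparated t → All (λ b → All (Separates b) y) (inorder t) →
                             Separated y → LeftSeparated (foldl (λ t a → insL a t) t y)
  foldl-insL-LeftSeparated t [] st _ _ = st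
  foldl-insL-LeftSeparated t (c ∷ y) st sep (sepᶜ ∷ seps) =
    foldl-insL-LeftSeparated (insL c t) y (insL-LeftSeparated c t st (All.map All.head sep))
      (All-resp-↭ (↭-sym (inorder-insL c t)) (sepᶜ ∷ All.map All.tail sep)) seps

  insL-LeftSeparated⁻ : ∀ c t → BST t → LeftSeparated (insL c t) →
                        LeftSeparated t × All (λ b → Separates b c) (inorder t)
  insL-LeftSeparated⁻ c lf _ _ = tt , []
  insL-LeftSeparated⁻ c (nd l b r) (l-bst , l≤b , b≤r , r-bst) s with c <? b | s
  ... | yes c<b | sl′ , cl<b , sr
      with All-resp-↭ (inorder-insL c l) cl<b | insL-LeftSeparated⁻ c l l-bst sl′
  ...   | dc<db ∷ l<b | sl , sepˡ =
    (sl , l<b , sr) , All.++⁺ sepˡ ((λ _ → dc<db) ∷ All.map (λ b≤x _ → <-≤-trans dc<db (d-mono b≤x)) b≤r)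
  insL-LeftSeparated⁻ c (nd l b r) (l-bst , l≤b , b≤r , r-bst) s | no c≮b | sl , l<b , sr′
      with insL-LeftSeparated⁻ c r r-bst sr′
  ...   | sr , sepʳ = (sl , l<b , sr) ,
    All.++⁺ (All.map (λ x≤b c<x → contradiction (<-≤-trans c<x x≤b) c≮b) l≤b)
            ((λ c<b → contradiction c<b c≮b) ∷ sepʳ)

  foldl-insL-LeftSeparated⁻ : ∀ t y → BST t → LeftSeparated (foldl (λ t a → insL a t) t y) →
                              LeftSeparated t × All (λ b → All (Separates b) y) (inorder t) × Separated y
  foldl-insL-LeftSeparated⁻ t [] _ st = st , All.universal (λ _ → []) (inorder t) , []
  foldl-insL-LeftSeparated⁻ t (c ∷ y) t-bst s
      with foldl-insL-LeftSeparated⁻ (insL c t) y (insL-BST c t t-bst) s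
  ... | s′ , sep′ , seps with insL-LeftSeparated⁻ c t t-bst s′ | All-resp-↭ (inorder-insL c t) sep′
  ...   | st , sepᶜ | sepᶜʸ ∷ sepᵗ = st , All.zipWith (λ (x , xs) → x ∷ xs) (sepᶜ , sepᵗ) , sepᶜʸ ∷ seps

  Separated⇔LeftSeparated : ∀ y → Separated y ⇔ LeftSeparated (ltree y)
  Separated⇔LeftSeparated y = mk⇔ (foldl-insL-LeftSeparated lf y tt [])
                                  (λ s → proj₂ (proj₂ (foldl-insL-LeftSeparated⁻ lf y tt s)))

  Separated-ltree : ∀ {y σ} → ltree y ≡ ltree σ → Separated σ → Separated y
  Separated-ltree {y} {σ} eq sep = Equivalence.from (Separated⇔LeftSeparated y)
    (subst LeftSeparated (sym eq) (Equivalence.to (Separated⇔LeftSeparated σ) sep))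

∈-insertions⁺ : ∀ a z₁ z₂ → z₁ ++ a ∷ z₂ ∈ insertions a (z₁ ++ z₂)
∈-insertions⁺ a [] [] = here refl
∈-insertions⁺ a [] (_ ∷ _) = here refl
∈-insertions⁺ a (b ∷ z₁) z₂ = there (∈-map⁺ (b ∷_) (∈-insertions⁺ a z₁ z₂))

∈-perms⁺ : ∀ w {z} → z ↭ w → z ∈ perms w
∈-perms⁺ [] p rewrite ↭-empty-inv p = here refl
∈-perms⁺ (a ∷ u) p with ∈-∃++ (∈-resp-↭ (↭-sym p) (here refl))
... | z₁ , z₂ , refl = ∈-concatMap⁺ (insertions a) {xs = perms u}
  (lose (∈-perms⁺ u (drop-mid z₁ [] p)) (∈-insertions⁺ a z₁ z₂))

∈-splits⁺ : ∀ x y → (x , y) ∈ splits (x ++ y)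
∈-splits⁺ [] [] = here refl
∈-splits⁺ [] (_ ∷ _) = here refl
∈-splits⁺ (a ∷ x) y = there (∈-map⁺ (λ p → a ∷ proj₁ p , proj₂ p) (∈-splits⁺ x y))

IsFactorisation : BTree × BTree → BTree × BTree → Word → Word × Word → Set
IsFactorisation U V w e = P (proj₁ e ++ proj₂ e) ≡ P w × Sh (P (proj₁ e)) ≡ U × Sh (P (proj₂ e)) ≡ V

P² : Word × Word → (LTree × LTree) × (LTree × LTree)
P² e = P (proj₁ e) , P (proj₂ e)

module _ (U V : BTree × BTree) (w : Word) where

  isFactorisation? : Decidable (IsFactorisation U V w)
  isFactorisation? e =
    (P (proj₁ e ++ proj₂ e) ≟P P w) ×-dec (Sh (P (proj₁ e)) ≟Sh U) ×-dec (Sh (P (proj₂ e)) ≟Sh V)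

  factorPairs-unique : Unique (factorPairs U V w)
  factorPairs-unique = deduplicate-! (≡-dec _≟P_ _≟P_) _

  ∈-factorPairs⁻ : ∀ {a} → a ∈ factorPairs U V w → ∃[ e ] IsFactorisation U V w e × P² e ≡ a
  ∈-factorPairs⁻ a∈ with ∈-map⁻ P² (Any.deduplicate⁻ (≡-dec _≟P_ _≟P_) a∈)
  ... | e , e∈ , refl = e , proj₂ (∈-filter⁻ isFactorisation? {xs = concatMap splits (perms w)} e∈) , refl

  ∈-factorPairs⁺ : ∀ e → IsFactorisation U V w e → P² e ∈ factorPairs U V w
  ∈-factorPairs⁺ (x , y) fact = Any.deduplicate⁺ (≡-dec _≟P_ _≟P_) (λ { refl a∈ → a∈ })
    (∈-map⁺ P² (∈-filter⁺ isFactorisation?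
      (∈-concatMap⁺ splits {xs = perms w} (lose (∈-perms⁺ w (P-↭ (proj₁ fact))) (∈-splits⁺ x y))) fact))

N-≤-by-injection : ∀ U V w w′ (H : Word × Word → Word × Word) →
  (∀ e → IsFactorisation U V w e → IsFactorisation U V w′ (H e)) →
  (∀ e₁ e₂ → IsFactorisation U V w e₁ → IsFactorisation U V w e₂ →
             P² (H e₁) ≡ P² (H e₂) → P² e₁ ≡ P² e₂) →
  N U V w ≤ N U V w′
N-≤-by-injection U V w w′ H fact inj =
  length-≤-by-injection Related (factorPairs-unique U V w) total (λ _ _ → Related-injective)
  where
  Related : (LTree × LTree) × (LTree × LTree) → (LTree × LTree) × (LTree × LTree) → Set
  Related a b = ∃[ e ] IsFactorisation U V w e × P² e ≡ a × P² (H e) ≡ b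
  total : ∀ {a} → a ∈ factorPairs U V w → ∃[ b ] b ∈ factorPairs U V w′ × Related a b
  total a∈ with ∈-factorPairs⁻ U V w a∈
  ... | e , f , refl = P² (H e) , ∈-factorPairs⁺ U V w′ (H e) (fact e f) , e , f , refl , refl
  Related-injective : ∀ {a a′ b} → Related a b → Related a′ b → a ≡ a′
  Related-injective (e₁ , f₁ , refl , h₁) (e₂ , f₂ , refl , h₂) = inj e₁ e₂ f₁ f₂ (trans h₁ (sym h₂))

N-resp-P : ∀ U V w w′ → P w ≡ P w′ → N U V w ≡ N U V w′
N-resp-P U V w w′ eq = ≤-antisym
  (N-≤-by-injection U V w w′ id (λ _ (Pe , shU , shV) → trans Pe eq , shU , shV) (λ _ _ _ _ → id))
  (N-≤-by-injection U V w′ w id (λ _ (Pe , shU , shV) → trans Pe (sym eq) , shU , shV) (λ _ _ _ _ → id))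

-- Standardisation preserves N

module Standardisation (w : Word) where

  σ : Word
  σ = std w w

  d : ℕ → ℕ
  d = destd w

  open Separation d (destd-mono w)

  σ-Separated : Separated σ
  σ-Separated = SameOrder⇒Separated
    (subst (SameOrder σ) (sym (destd-std {w} ↭-refl)) (SameOrder-sym (std-SameOrder {w} ↭-refl)))

  ↭-++-[] : ∀ x y → x ++ y ↭ w → x ++ y ++ [] ↭ w
  ↭-++-[] x y = ↭-trans (++⁺ˡ x (++-identityʳ y))

  stdPair : Word × Word → Word × Word
  stdPair e = std w (proj₁ e) , stdFrom w (proj₁ e) (proj₂ e)

  destdPair : Word × Word → Word × Word
  destdPair e = map d (proj₁ e) , map d (proj₂ e)

  destdPair-stdPair : ∀ x y → x ++ y ↭ w → destdPair (stdPair (x , y)) ≡ (x , y)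
  destdPair-stdPair x y p = cong₂ _,_ (destd-stdFrom w [] x y p) (destd-stdFrom w x y [] (↭-++-[] x y p))

  stdPair-isFactorisation : ∀ {U V} e → IsFactorisation U V w e → IsFactorisation U V σ (stdPair e)
  stdPair-isFactorisation (x , y) (Pxy , shU , shV) =
    subst (λ z → P z ≡ P σ) (stdFrom-++ w [] x y) (P-≡ (stdFrom-↭ w [] p) shapes) ,
    trans (sym (SameOrder⇒Sh (stdFrom-SameOrder w [] x y p))) shU ,
    trans (sym (SameOrder⇒Sh (stdFrom-SameOrder w x y [] (↭-++-[] x y p)))) shV
    where
    p = P-↭ {x ++ y} Pxy
    shapes : Sh (P (std w (x ++ y))) ≡ Sh (P σ)
    shapes = begin
      Sh (P (std w (x ++ y))) ≡⟨ SameOrder⇒Sh (std-SameOrder p) ⟨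
      Sh (P (x ++ y))         ≡⟨ cong Sh Pxy ⟩
      Sh (P w)                ≡⟨ SameOrder⇒Sh (std-SameOrder {w} ↭-refl) ⟩
      Sh (P σ)                ∎
      where open ≡-Reasoning

  stdPair-injective : ∀ {U V} e₁ e₂ → IsFactorisation U V w e₁ → IsFactorisation U V w e₂ →
                      P² (stdPair e₁) ≡ P² (stdPair e₂) → P² e₁ ≡ P² e₂
  stdPair-injective (x₁ , y₁) (x₂ , y₂) (P₁ , U₁ , V₁) (P₂ , U₂ , V₂) eq = cong₂ _,_
    (P-≡-by-retraction d {s₁ = std w x₁} {std w x₂}
      (cong proj₁ r₁) (cong proj₁ r₂) (cong proj₁ eq) (trans U₁ (sym U₂)))
    (P-≡-by-retraction d {s₁ = stdFrom w x₁ y₁} {stdFrom w x₂ y₂}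
      (cong proj₂ r₁) (cong proj₂ r₂) (cong proj₂ eq) (trans V₁ (sym V₂)))
    where
    r₁ = destdPair-stdPair x₁ y₁ (P-↭ {x₁ ++ y₁} P₁)
    r₂ = destdPair-stdPair x₂ y₂ (P-↭ {x₂ ++ y₂} P₂)

  module _ (s t : Word) (Pst : P (s ++ t) ≡ P σ) where

    factor-Separated : Separated (s ++ t)
    factor-Separated = Separated-ltree (cong proj₁ Pst) σ-Separated

    destd-factor-↭ : map d s ++ map d t ↭ w
    destd-factor-↭ = subst₂ _↭_ (map-++ d s t) (destd-std {w} ↭-refl) (map⁺ d (P-↭ {s ++ t} Pst))

    stdPair-destdPair : stdPair (destdPair (s , t)) ≡ (s , t)
    stdPair-destdPair = Product.uncurry (cong₂ _,_)
      (++-injective length-eq (trans (sym (stdFrom-++ w [] (map d s) (map d t))) std-eq))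
      where
      length-eq : length (std w (map d s)) ≡ length s
      length-eq = trans (length-stdFrom w [] (map d s)) (length-map d s)
      sameOrder : SameOrder (std w (map d s ++ map d t)) (s ++ t)
      sameOrder = SameOrder-trans (SameOrder-sym (std-SameOrder destd-factor-↭))
        (SameOrder-sym (subst (SameOrder (s ++ t)) (map-++ d s t) (Separated⇒SameOrder factor-Separated)))
      std-eq : std w (map d s ++ map d t) ≡ s ++ t
      std-eq = SameOrder-↭⇒≡ (↭-trans (stdFrom-↭ w [] destd-factor-↭) (↭-sym (P-↭ {s ++ t} Pst))) sameOrder

  destdPair-isFactorisation : ∀ {U V} e → IsFactorisation U V σ e → IsFactorisation U V w (destdPair e)
  destdPair-isFactorisation (s , t) (Pst , shU , shV) =
    subst (λ z → P z ≡ P w) (map-++ d s t)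
          (P-≡ (subst (_↭ w) (sym (map-++ d s t)) (destd-factor-↭ s t Pst)) shapes) ,
    trans (sym (SameOrder⇒Sh (Separated⇒SameOrder sep-s))) shU ,
    trans (sym (SameOrder⇒Sh (Separated⇒SameOrder sep-t))) shV
    where
    sep = factor-Separated s t Pst
    sep-s = proj₁ (AllPairs-++⁻ s sep)
    sep-t = proj₂ (AllPairs-++⁻ s sep)
    shapes : Sh (P (map d (s ++ t))) ≡ Sh (P w)
    shapes = begin
      Sh (P (map d (s ++ t))) ≡⟨ SameOrder⇒Sh (Separated⇒SameOrder sep) ⟨
      Sh (P (s ++ t))         ≡⟨ cong Sh Pst ⟩
      Sh (P σ)                ≡⟨ SameOrder⇒Sh (std-SameOrder {w} ↭-refl) ⟨
      Sh (P w)                ∎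
      where open ≡-Reasoning

  destdPair-injective : ∀ {U V} e₁ e₂ → IsFactorisation U V σ e₁ → IsFactorisation U V σ e₂ →
                        P² (destdPair e₁) ≡ P² (destdPair e₂) → P² e₁ ≡ P² e₂
  destdPair-injective (s₁ , t₁) (s₂ , t₂) (P₁ , U₁ , V₁) (P₂ , U₂ , V₂) eq =
    cong₂ _,_ (P-≡ s↭ (trans U₁ (sym U₂))) (P-≡ t↭ (trans V₁ (sym V₂)))
    where
    r₁ = stdPair-destdPair s₁ t₁ P₁
    r₂ = stdPair-destdPair s₂ t₂ P₂
    ms : map d s₁ ↭ map d s₂
    ms = P-↭ {map d s₁} (cong proj₁ eq)
    mt : map d t₁ ↭ map d t₂
    mt = P-↭ {map d t₁} (cong proj₂ eq)
    s↭ : s₁ ↭ s₂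
    s↭ = subst₂ _↭_ (cong proj₁ r₁) (cong proj₁ r₂) (stdFrom-↭ w [] ms)
    t↭ : t₁ ↭ t₂
    t↭ = subst₂ _↭_ (cong proj₂ r₁) (cong proj₂ r₂)
      (↭-trans (stdFrom-↭ w (map d s₁) mt) (↭-reflexive (stdFrom-resp-↭ w (map d t₂) ms)))

  N-std : ∀ U V → N U V w ≡ N U V σ
  N-std U V = ≤-antisym
    (N-≤-by-injection U V w σ stdPair stdPair-isFactorisation stdPair-injective)
    (N-≤-by-injection U V σ w destdPair destdPair-isFactorisation destdPair-injective)

P-std-resp-Sh : ∀ w w′ → Sh (P w) ≡ Sh (P w′) → P (std w w) ≡ P (std w′ w′)
P-std-resp-Sh w w′ sh = P-≡
  (↭-trans (std-↭-upTo _ w length-eq) (↭-sym (std-↭-upTo _ w′ refl)))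
  (trans (sym (SameOrder⇒Sh (std-SameOrder {w} ↭-refl)))
         (trans sh (SameOrder⇒Sh (std-SameOrder {w′} ↭-refl))))
  where
  length-eq : length w ≡ length w′
  length-eq = trans (length-Sh w) (trans (cong (size ∘ proj₂) sh) (sym (length-Sh w′)))

theorem5 : (TL TR UL UR VL VR : BTree) (w w' : Word)
    → All (1 ≤_) w → All (1 ≤_) w'
    → Sh (P w) ≡ (TL , TR) → Sh (P w') ≡ (TL , TR)
    → N (UL , UR) (VL , VR) w ≡ N (UL , UR) (VL , VR) w'
-- The letters need not be positive.
theorem5 TL TR UL UR VL VR w w' _ _ sh sh' = begin
  N U V w           ≡⟨ Standardisation.N-std w U V ⟩
  N U V (std w w)   ≡⟨ N-resp-P U V (std w w) (std w' w') (P-std-resp-Sh w w' (trans sh (sym sh'))) ⟩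
  N U V (std w' w') ≡⟨ Standardisation.N-std w' U V ⟨
  N U V w'          ∎
  where
  open ≡-Reasoning
  U = UL , UR
  V = VL , VR
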